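{- Let $P\in\mathbb{Z}[x]$ and let $\mathcal{N}\subset\mathbb{Z}$ be a finite set. If $\mathbb{Z}[x]=\mathcal{N}[x]+(P)$, then for every $m\in\mathbb{N}$ there exists a finite set $\mathcal{N}_m\subset\mathbb{Z}$ such that $\mathbb{Z}[x]=\mathcal{N}_m[x]+(P^m)$.
   Context: For a finite set $\mathcal{N}\subset\mathbb{Z}$, $\mathcal{N}[x]:=\{d_0+d_1x+\dots+d_kx^k : k\ge 0,\ d_j\in\mathcal{N}\}$ denotes the set of polynomials all of whose coefficients lie in $\mathcal{N}$. For $P\in\mathbb{Z}[x]$, $(P)$ denotes the principal ideal of $\mathbb{Z}[x]$ generated by $P$, and $\mathcal{N}[x]+(P)=\{R+S : R\in\mathcal{N}[x], S\in(P)\}$. -}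

module Defs where

open import Data.Nat using (ℕ; zero; suc)
open import Data.Integer using (ℤ; 0ℤ; 1ℤ) renaming (_+_ to _+ℤ_; _*_ to _*ℤ_)
open import Data.List using (List; []; _∷_)
open import Data.List.Relation.Unary.All using (All)
open import Data.List.Membership.Propositional using (_∈_)
open import Data.Product using (Σ; _×_)
open import Relation.Binary.PropositionalEquality using (_≡_)

-- An integer polynomial d₀ + d₁x + … + d_k x^k is represented by its
-- coefficient list [d₀, d₁, …, d_k] (lowest degree first).
Poly : Set
Poly = List ℤ

coeff : Poly → ℕ → ℤ
coeff []       _       = 0ℤ
coeff (a ∷ _)  zero    = a
coeff (_ ∷ p)  (suc n) = coeff p n

-- Equality of polynomials in ℤ[x]: all coefficients agree
-- (so trailing zero coefficients are irrelevant).
_≈ₚ_ : Poly → Poly → Set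
p ≈ₚ q = ∀ n → coeff p n ≡ coeff q n

infixl 6 _+ₚ_
infixl 7 _*ₚ_ _·ₚ_

_+ₚ_ : Poly → Poly → Poly
[]      +ₚ q       = q
p       +ₚ []      = p
(a ∷ p) +ₚ (b ∷ q) = (a +ℤ b) ∷ (p +ₚ q)

_·ₚ_ : ℤ → Poly → Poly
c ·ₚ []      = []
c ·ₚ (a ∷ p) = (c *ℤ a) ∷ (c ·ₚ p)

-- (a + x p) * q = a q + x (p q)
_*ₚ_ : Poly → Poly → Poly
[]      *ₚ q = []
(a ∷ p) *ₚ q = (a ·ₚ q) +ₚ (0ℤ ∷ (p *ₚ q))

_^ₚ_ : Poly → ℕ → Poly
p ^ₚ zero  = 1ℤ ∷ []
p ^ₚ suc m = p *ₚ (p ^ₚ m)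

-- A finite set 𝒩 ⊂ ℤ is given as a list of its elements.
-- R ∈ 𝒩[x]: every coefficient of R lies in 𝒩.
_∈[x]_ : Poly → List ℤ → Set
R ∈[x] 𝒩 = All (_∈ 𝒩) R

-- ℤ[x] = 𝒩[x] + (P): every F ∈ ℤ[x] equals R + S·P with R ∈ 𝒩[x], S ∈ ℤ[x].
-- (The inclusion ⊇ is automatic.)
CoversZx : List ℤ → Poly → Set
CoversZx 𝒩 P = ∀ (F : Poly) → Σ Poly λ R → Σ Poly λ S →
  (R ∈[x] 𝒩) × (F ≈ₚ (R +ₚ (S *ₚ P)))

{-# OPTIONS --safe #-}
-- If every F ∈ ℤ[x] is R + S P with R ∈ 𝒩[x], then it is also R + S Pᵐ with the
-- coefficients of R bounded by some b depending only on P, 𝒩 and m, so the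
-- interval [-b, b] serves as 𝒩ₘ.  The bound is built by induction on m: given
-- F = R + S Pᵐ, write S = R' + S' P with R' ∈ 𝒩[x]; then
-- F = (R + R' Pᵐ) + S' Pᵐ⁺¹, and every coefficient of R' Pᵐ is at most
-- (Σ_{d ∈ 𝒩} |d|) · (Σ_j |coeff Pᵐ j|) in absolute value.
module Submission where

open import Defs
open import Data.Nat using (ℕ; zero; suc)
open import Data.Integer using (ℤ)
open import Data.List using (List)
open import Data.Product using (Σ)

open import Data.Nat as ℕ using (_≤_; z≤n; s≤s)
import Data.Nat.Properties as ℕ
open import Data.Nat.Tactic.RingSolver renaming (solve-∀ to ℕ-solve-∀)
open import Data.Integer as ℤ using (+_; -[1+_]; ∣_∣; 0ℤ; 1ℤ) renaming (_+_ to _+ℤ_; _*_ to _*ℤ_)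
import Data.Integer.Properties as ℤ
open import Data.Integer.Tactic.RingSolver using (solve-∀)
open import Data.List using ([]; _∷_; drop)
open import Data.List.Relation.Unary.All using ([]; _∷_)
open import Data.List.Relation.Unary.Any using (here; there)
open import Data.List.Membership.Propositional using (_∈_)
open import Data.Product using (_,_; _×_)
open import Data.Sum using (inj₁; inj₂)
open import Relation.Binary.Bundles using (Setoid)
import Relation.Binary.Reasoning.Setoid
open import Relation.Binary.PropositionalEquality
  using (_≡_; refl; sym; trans; cong; cong₂; module ≡-Reasoning)

≈ₚ-setoid : Setoid _ _
≈ₚ-setoid = record
  { Carrier = Poly
  ; _≈_ = _≈ₚ_
  ; isEquivalence = record
    { refl = λ n → refl
    ; sym = λ p≈q n → sym (p≈q n)
    ; trans = λ p≈q q≈r n → trans (p≈q n) (q≈r n)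
    }
  }

module ≈ₚ-Reasoning = Relation.Binary.Reasoning.Setoid ≈ₚ-setoid

coeff-+ₚ : ∀ p q n → coeff (p +ₚ q) n ≡ coeff p n +ℤ coeff q n
coeff-+ₚ []      q       n       = sym (ℤ.+-identityˡ _)
coeff-+ₚ (a ∷ p) []      n       = sym (ℤ.+-identityʳ _)
coeff-+ₚ (a ∷ p) (b ∷ q) zero    = refl
coeff-+ₚ (a ∷ p) (b ∷ q) (suc n) = coeff-+ₚ p q n

coeff-·ₚ : ∀ c p n → coeff (c ·ₚ p) n ≡ c *ℤ coeff p n
coeff-·ₚ c []      n       = sym (ℤ.*-zeroʳ c)
coeff-·ₚ c (a ∷ p) zero    = refl
coeff-·ₚ c (a ∷ p) (suc n) = coeff-·ₚ c p n

coeff-drop-1 : ∀ p n → coeff (drop 1 p) n ≡ coeff p (suc n)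
coeff-drop-1 []      n = refl
coeff-drop-1 (a ∷ p) n = refl

-- Valid also for p = []: with it, product identities are proved by induction on the
-- coefficient index, with no case split on the lengths of the coefficient lists.
coeff-*ₚ : ∀ p q n → coeff (p *ₚ q) n ≡ coeff p 0 *ℤ coeff q n +ℤ coeff (0ℤ ∷ (drop 1 p *ₚ q)) n
coeff-*ₚ []      q zero    = sym (trans (ℤ.+-identityʳ _) (ℤ.*-zeroˡ (coeff q 0)))
coeff-*ₚ []      q (suc n) = sym (trans (ℤ.+-identityʳ _) (ℤ.*-zeroˡ (coeff q (suc n))))
coeff-*ₚ (a ∷ p) q n       = trans (coeff-+ₚ (a ·ₚ q) _ n) (cong (_+ℤ _) (coeff-·ₚ a q n))

coeff-*ₚ-zero : ∀ p q → coeff (p *ₚ q) 0 ≡ coeff p 0 *ℤ coeff q 0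
coeff-*ₚ-zero p q = trans (coeff-*ₚ p q 0) (ℤ.+-identityʳ _)

drop-1-+ₚ : ∀ p q → drop 1 (p +ₚ q) ≈ₚ (drop 1 p +ₚ drop 1 q)
drop-1-+ₚ p q n = begin
  coeff (drop 1 (p +ₚ q)) n                ≡⟨ coeff-drop-1 (p +ₚ q) n ⟩
  coeff (p +ₚ q) (suc n)                   ≡⟨ coeff-+ₚ p q (suc n) ⟩
  coeff p (suc n) +ℤ coeff q (suc n)       ≡⟨ sym (cong₂ _+ℤ_ (coeff-drop-1 p n) (coeff-drop-1 q n)) ⟩
  coeff (drop 1 p) n +ℤ coeff (drop 1 q) n ≡⟨ sym (coeff-+ₚ (drop 1 p) (drop 1 q) n) ⟩
  coeff (drop 1 p +ₚ drop 1 q) n           ∎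
  where open ≡-Reasoning

drop-1-·ₚ : ∀ c p → drop 1 (c ·ₚ p) ≡ c ·ₚ drop 1 p
drop-1-·ₚ c []      = refl
drop-1-·ₚ c (a ∷ p) = refl

+ₚ-cong : ∀ p p′ q q′ → p ≈ₚ p′ → q ≈ₚ q′ → (p +ₚ q) ≈ₚ (p′ +ₚ q′)
+ₚ-cong p p′ q q′ p≈p′ q≈q′ n = begin
  coeff (p +ₚ q) n         ≡⟨ coeff-+ₚ p q n ⟩
  coeff p n +ℤ coeff q n   ≡⟨ cong₂ _+ℤ_ (p≈p′ n) (q≈q′ n) ⟩
  coeff p′ n +ℤ coeff q′ n ≡⟨ sym (coeff-+ₚ p′ q′ n) ⟩
  coeff (p′ +ₚ q′) n       ∎
  where open ≡-Reasoning

+ₚ-assoc : ∀ p q r → ((p +ₚ q) +ₚ r) ≈ₚ (p +ₚ (q +ₚ r))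
+ₚ-assoc p q r n = begin
  coeff ((p +ₚ q) +ₚ r) n                    ≡⟨ coeff-+ₚ (p +ₚ q) r n ⟩
  coeff (p +ₚ q) n +ℤ coeff r n              ≡⟨ cong (_+ℤ coeff r n) (coeff-+ₚ p q n) ⟩
  (coeff p n +ℤ coeff q n) +ℤ coeff r n      ≡⟨ ℤ.+-assoc (coeff p n) (coeff q n) (coeff r n) ⟩
  coeff p n +ℤ (coeff q n +ℤ coeff r n)      ≡⟨ cong (coeff p n +ℤ_) (sym (coeff-+ₚ q r n)) ⟩
  coeff p n +ℤ coeff (q +ₚ r) n              ≡⟨ sym (coeff-+ₚ p (q +ₚ r) n) ⟩
  coeff (p +ₚ (q +ₚ r)) n                    ∎
  where open ≡-Reasoning

*ₚ-congˡ : ∀ p p′ q → p ≈ₚ p′ → (p *ₚ q) ≈ₚ (p′ *ₚ q)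
*ₚ-congˡ p p′ q p≈p′ zero = begin
  coeff (p *ₚ q) 0           ≡⟨ coeff-*ₚ-zero p q ⟩
  coeff p 0 *ℤ coeff q 0     ≡⟨ cong (_*ℤ coeff q 0) (p≈p′ 0) ⟩
  coeff p′ 0 *ℤ coeff q 0    ≡⟨ sym (coeff-*ₚ-zero p′ q) ⟩
  coeff (p′ *ₚ q) 0          ∎
  where open ≡-Reasoning
*ₚ-congˡ p p′ q p≈p′ (suc n) = begin
  coeff (p *ₚ q) (suc n)
    ≡⟨ coeff-*ₚ p q (suc n) ⟩
  coeff p 0 *ℤ coeff q (suc n) +ℤ coeff (drop 1 p *ₚ q) n
    ≡⟨ cong₂ _+ℤ_ (cong (_*ℤ coeff q (suc n)) (p≈p′ 0)) (*ₚ-congˡ (drop 1 p) (drop 1 p′) q tail≈ n) ⟩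
  coeff p′ 0 *ℤ coeff q (suc n) +ℤ coeff (drop 1 p′ *ₚ q) n
    ≡⟨ sym (coeff-*ₚ p′ q (suc n)) ⟩
  coeff (p′ *ₚ q) (suc n) ∎
  where
  open ≡-Reasoning
  tail≈ : drop 1 p ≈ₚ drop 1 p′
  tail≈ k = trans (coeff-drop-1 p k) (trans (p≈p′ (suc k)) (sym (coeff-drop-1 p′ k)))

*ₚ-distribʳ-+ₚ : ∀ p q r → ((p +ₚ q) *ₚ r) ≈ₚ ((p *ₚ r) +ₚ (q *ₚ r))
*ₚ-distribʳ-+ₚ p q r zero = begin
  coeff ((p +ₚ q) *ₚ r) 0                            ≡⟨ coeff-*ₚ-zero (p +ₚ q) r ⟩
  coeff (p +ₚ q) 0 *ℤ coeff r 0                      ≡⟨ cong (_*ℤ coeff r 0) (coeff-+ₚ p q 0) ⟩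
  (coeff p 0 +ℤ coeff q 0) *ℤ coeff r 0              ≡⟨ ℤ.*-distribʳ-+ (coeff r 0) (coeff p 0) (coeff q 0) ⟩
  coeff p 0 *ℤ coeff r 0 +ℤ coeff q 0 *ℤ coeff r 0   ≡⟨ sym (cong₂ _+ℤ_ (coeff-*ₚ-zero p r) (coeff-*ₚ-zero q r)) ⟩
  coeff (p *ₚ r) 0 +ℤ coeff (q *ₚ r) 0               ≡⟨ sym (coeff-+ₚ (p *ₚ r) (q *ₚ r) 0) ⟩
  coeff ((p *ₚ r) +ₚ (q *ₚ r)) 0                     ∎
  where open ≡-Reasoning
*ₚ-distribʳ-+ₚ p q r (suc n) = begin
  coeff ((p +ₚ q) *ₚ r) (suc n)
    ≡⟨ coeff-*ₚ (p +ₚ q) r (suc n) ⟩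
  coeff (p +ₚ q) 0 *ℤ rₙ +ℤ coeff (drop 1 (p +ₚ q) *ₚ r) n
    ≡⟨ cong₂ _+ℤ_ (cong (_*ℤ rₙ) (coeff-+ₚ p q 0))
                  (*ₚ-congˡ (drop 1 (p +ₚ q)) (drop 1 p +ₚ drop 1 q) r (drop-1-+ₚ p q) n) ⟩
  (p₀ +ℤ q₀) *ℤ rₙ +ℤ coeff ((drop 1 p +ₚ drop 1 q) *ₚ r) n
    ≡⟨ cong ((p₀ +ℤ q₀) *ℤ rₙ +ℤ_) (trans (*ₚ-distribʳ-+ₚ (drop 1 p) (drop 1 q) r n)
                                           (coeff-+ₚ (drop 1 p *ₚ r) (drop 1 q *ₚ r) n)) ⟩
  (p₀ +ℤ q₀) *ℤ rₙ +ℤ (coeff (drop 1 p *ₚ r) n +ℤ coeff (drop 1 q *ₚ r) n)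
    ≡⟨ rearrange p₀ q₀ rₙ _ _ ⟩
  (p₀ *ℤ rₙ +ℤ coeff (drop 1 p *ₚ r) n) +ℤ (q₀ *ℤ rₙ +ℤ coeff (drop 1 q *ₚ r) n)
    ≡⟨ sym (cong₂ _+ℤ_ (coeff-*ₚ p r (suc n)) (coeff-*ₚ q r (suc n))) ⟩
  coeff (p *ₚ r) (suc n) +ℤ coeff (q *ₚ r) (suc n)
    ≡⟨ sym (coeff-+ₚ (p *ₚ r) (q *ₚ r) (suc n)) ⟩
  coeff ((p *ₚ r) +ₚ (q *ₚ r)) (suc n) ∎
  where
  open ≡-Reasoning
  p₀ = coeff p 0
  q₀ = coeff q 0
  rₙ = coeff r (suc n)
  rearrange : ∀ a b c x y → (a +ℤ b) *ℤ c +ℤ (x +ℤ y) ≡ (a *ℤ c +ℤ x) +ℤ (b *ℤ c +ℤ y)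
  rearrange = solve-∀

·ₚ-*ₚ-assoc : ∀ c p q → ((c ·ₚ p) *ₚ q) ≈ₚ (c ·ₚ (p *ₚ q))
·ₚ-*ₚ-assoc c p q zero = begin
  coeff ((c ·ₚ p) *ₚ q) 0            ≡⟨ coeff-*ₚ-zero (c ·ₚ p) q ⟩
  coeff (c ·ₚ p) 0 *ℤ coeff q 0      ≡⟨ cong (_*ℤ coeff q 0) (coeff-·ₚ c p 0) ⟩
  c *ℤ coeff p 0 *ℤ coeff q 0        ≡⟨ ℤ.*-assoc c (coeff p 0) (coeff q 0) ⟩
  c *ℤ (coeff p 0 *ℤ coeff q 0)      ≡⟨ cong (c *ℤ_) (sym (coeff-*ₚ-zero p q)) ⟩
  c *ℤ coeff (p *ₚ q) 0              ≡⟨ sym (coeff-·ₚ c (p *ₚ q) 0) ⟩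
  coeff (c ·ₚ (p *ₚ q)) 0            ∎
  where open ≡-Reasoning
·ₚ-*ₚ-assoc c p q (suc n) = begin
  coeff ((c ·ₚ p) *ₚ q) (suc n)
    ≡⟨ coeff-*ₚ (c ·ₚ p) q (suc n) ⟩
  coeff (c ·ₚ p) 0 *ℤ qₙ +ℤ coeff (drop 1 (c ·ₚ p) *ₚ q) n
    ≡⟨ cong₂ (λ x t → x *ℤ qₙ +ℤ coeff (t *ₚ q) n) (coeff-·ₚ c p 0) (drop-1-·ₚ c p) ⟩
  c *ℤ p₀ *ℤ qₙ +ℤ coeff ((c ·ₚ drop 1 p) *ₚ q) n
    ≡⟨ cong (c *ℤ p₀ *ℤ qₙ +ℤ_) (trans (·ₚ-*ₚ-assoc c (drop 1 p) q n) (coeff-·ₚ c (drop 1 p *ₚ q) n)) ⟩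
  c *ℤ p₀ *ℤ qₙ +ℤ c *ℤ coeff (drop 1 p *ₚ q) n
    ≡⟨ rearrange c p₀ qₙ _ ⟩
  c *ℤ (p₀ *ℤ qₙ +ℤ coeff (drop 1 p *ₚ q) n)
    ≡⟨ cong (c *ℤ_) (sym (coeff-*ₚ p q (suc n))) ⟩
  c *ℤ coeff (p *ₚ q) (suc n)
    ≡⟨ sym (coeff-·ₚ c (p *ₚ q) (suc n)) ⟩
  coeff (c ·ₚ (p *ₚ q)) (suc n) ∎
  where
  open ≡-Reasoning
  p₀ = coeff p 0
  qₙ = coeff q (suc n)
  rearrange : ∀ c a b x → c *ℤ a *ℤ b +ℤ c *ℤ x ≡ c *ℤ (a *ℤ b +ℤ x)
  rearrange = solve-∀

∷-cong : ∀ a {p q} → p ≈ₚ q → (a ∷ p) ≈ₚ (a ∷ q)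
∷-cong a p≈q zero    = refl
∷-cong a p≈q (suc n) = p≈q n

*ₚ-shiftˡ : ∀ p q → ((0ℤ ∷ p) *ₚ q) ≈ₚ (0ℤ ∷ (p *ₚ q))
*ₚ-shiftˡ p q n = begin
  coeff ((0ℤ ∷ p) *ₚ q) n                    ≡⟨ coeff-*ₚ (0ℤ ∷ p) q n ⟩
  0ℤ *ℤ coeff q n +ℤ coeff (0ℤ ∷ (p *ₚ q)) n ≡⟨ cong (_+ℤ coeff (0ℤ ∷ (p *ₚ q)) n) (ℤ.*-zeroˡ (coeff q n)) ⟩
  0ℤ +ℤ coeff (0ℤ ∷ (p *ₚ q)) n              ≡⟨ ℤ.+-identityˡ _ ⟩
  coeff (0ℤ ∷ (p *ₚ q)) n                    ∎
  where open ≡-Reasoning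

*ₚ-assoc : ∀ p q r → ((p *ₚ q) *ₚ r) ≈ₚ (p *ₚ (q *ₚ r))
*ₚ-assoc []      q r n = refl
*ₚ-assoc (a ∷ p) q r = begin
  ((a ·ₚ q) +ₚ (0ℤ ∷ (p *ₚ q))) *ₚ r
    ≈⟨ *ₚ-distribʳ-+ₚ (a ·ₚ q) (0ℤ ∷ (p *ₚ q)) r ⟩
  ((a ·ₚ q) *ₚ r) +ₚ ((0ℤ ∷ (p *ₚ q)) *ₚ r)
    ≈⟨ +ₚ-cong ((a ·ₚ q) *ₚ r) (a ·ₚ (q *ₚ r)) ((0ℤ ∷ (p *ₚ q)) *ₚ r) (0ℤ ∷ ((p *ₚ q) *ₚ r))
               (·ₚ-*ₚ-assoc a q r) (*ₚ-shiftˡ (p *ₚ q) r) ⟩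
  (a ·ₚ (q *ₚ r)) +ₚ (0ℤ ∷ ((p *ₚ q) *ₚ r))
    ≈⟨ +ₚ-cong (a ·ₚ (q *ₚ r)) (a ·ₚ (q *ₚ r)) (0ℤ ∷ ((p *ₚ q) *ₚ r)) (0ℤ ∷ (p *ₚ (q *ₚ r)))
               (λ _ → refl) (∷-cong 0ℤ (*ₚ-assoc p q r)) ⟩
  (a ·ₚ (q *ₚ r)) +ₚ (0ℤ ∷ (p *ₚ (q *ₚ r))) ∎
  where open ≈ₚ-Reasoning

*ₚ-zeroʳ : ∀ p → (p *ₚ []) ≈ₚ []
*ₚ-zeroʳ []      n       = refl
*ₚ-zeroʳ (a ∷ p) zero    = refl
*ₚ-zeroʳ (a ∷ p) (suc n) = *ₚ-zeroʳ p n

*ₚ-identityʳ : ∀ p → (p *ₚ (1ℤ ∷ [])) ≈ₚ p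
*ₚ-identityʳ []      n       = refl
*ₚ-identityʳ (a ∷ p) zero    = trans (ℤ.+-identityʳ _) (ℤ.*-identityʳ a)
*ₚ-identityʳ (a ∷ p) (suc n) = *ₚ-identityʳ p n

coeff-*ₚ-∷ʳ : ∀ p b q n → coeff (p *ₚ (b ∷ q)) n ≡ b *ℤ coeff p n +ℤ coeff (0ℤ ∷ (p *ₚ q)) n
coeff-*ₚ-∷ʳ p b q zero = trans (coeff-*ₚ-zero p (b ∷ q)) (trans (ℤ.*-comm (coeff p 0) b) (sym (ℤ.+-identityʳ _)))
coeff-*ₚ-∷ʳ p b q (suc n) = begin
  coeff (p *ₚ (b ∷ q)) (suc n)
    ≡⟨ coeff-*ₚ p (b ∷ q) (suc n) ⟩
  p₀ *ℤ qₙ +ℤ coeff (drop 1 p *ₚ (b ∷ q)) n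
    ≡⟨ cong (p₀ *ℤ qₙ +ℤ_) (coeff-*ₚ-∷ʳ (drop 1 p) b q n) ⟩
  p₀ *ℤ qₙ +ℤ (b *ℤ coeff (drop 1 p) n +ℤ coeff (0ℤ ∷ (drop 1 p *ₚ q)) n)
    ≡⟨ cong (λ x → p₀ *ℤ qₙ +ℤ (b *ℤ x +ℤ coeff (0ℤ ∷ (drop 1 p *ₚ q)) n)) (coeff-drop-1 p n) ⟩
  p₀ *ℤ qₙ +ℤ (b *ℤ coeff p (suc n) +ℤ coeff (0ℤ ∷ (drop 1 p *ₚ q)) n)
    ≡⟨ rearrange (p₀ *ℤ qₙ) (b *ℤ coeff p (suc n)) _ ⟩
  b *ℤ coeff p (suc n) +ℤ (p₀ *ℤ qₙ +ℤ coeff (0ℤ ∷ (drop 1 p *ₚ q)) n)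
    ≡⟨ cong (b *ℤ coeff p (suc n) +ℤ_) (sym (coeff-*ₚ p q n)) ⟩
  b *ℤ coeff p (suc n) +ℤ coeff (p *ₚ q) n ∎
  where
  open ≡-Reasoning
  p₀ = coeff p 0
  qₙ = coeff q n
  rearrange : ∀ x y z → x +ℤ (y +ℤ z) ≡ y +ℤ (x +ℤ z)
  rearrange = solve-∀

Bounded : ℕ → Poly → Set
Bounded b p = ∀ n → ∣ coeff p n ∣ ≤ b

‖_‖₁ : List ℤ → ℕ
‖ []    ‖₁ = 0
‖ a ∷ p ‖₁ = ∣ a ∣ ℕ.+ ‖ p ‖₁

Bounded-+ₚ : ∀ {b c} p q → Bounded b p → Bounded c q → Bounded (b ℕ.+ c) (p +ₚ q)
Bounded-+ₚ p q p≤b q≤c n rewrite coeff-+ₚ p q n =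
  ℕ.≤-trans (ℤ.∣i+j∣≤∣i∣+∣j∣ (coeff p n) (coeff q n)) (ℕ.+-mono-≤ (p≤b n) (q≤c n))

Bounded-∷ : ∀ {b} p → Bounded b p → Bounded b (0ℤ ∷ p)
Bounded-∷ p p≤b zero    = z≤n
Bounded-∷ p p≤b (suc n) = p≤b n

Bounded-*ₚ : ∀ {c} p q → Bounded c p → Bounded (c ℕ.* ‖ q ‖₁) (p *ₚ q)
Bounded-*ₚ p [] p≤c n rewrite *ₚ-zeroʳ p n = z≤n
Bounded-*ₚ {c} p (b ∷ q) p≤c n = begin
  ∣ coeff (p *ₚ (b ∷ q)) n ∣                              ≡⟨ cong ∣_∣ (coeff-*ₚ-∷ʳ p b q n) ⟩
  ∣ b *ℤ coeff p n +ℤ coeff (0ℤ ∷ (p *ₚ q)) n ∣           ≤⟨ ℤ.∣i+j∣≤∣i∣+∣j∣ (b *ℤ coeff p n) _ ⟩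
  ∣ b *ℤ coeff p n ∣ ℕ.+ ∣ coeff (0ℤ ∷ (p *ₚ q)) n ∣      ≤⟨ ℕ.+-mono-≤ bp≤ (Bounded-∷ (p *ₚ q) (Bounded-*ₚ p q p≤c) n) ⟩
  ∣ b ∣ ℕ.* c ℕ.+ c ℕ.* ‖ q ‖₁                           ≡⟨ rearrange ∣ b ∣ c ‖ q ‖₁ ⟩
  c ℕ.* (∣ b ∣ ℕ.+ ‖ q ‖₁)                               ∎
  where
  open ℕ.≤-Reasoning
  bp≤ : ∣ b *ℤ coeff p n ∣ ≤ ∣ b ∣ ℕ.* c
  bp≤ = ℕ.≤-trans (ℕ.≤-reflexive (ℤ.abs-* b (coeff p n))) (ℕ.*-monoʳ-≤ ∣ b ∣ (p≤c n))
  rearrange : ∀ x c l → x ℕ.* c ℕ.+ c ℕ.* l ≡ c ℕ.* (x ℕ.+ l)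
  rearrange = ℕ-solve-∀

∈⇒∣∣≤‖‖₁ : ∀ {x} 𝒩 → x ∈ 𝒩 → ∣ x ∣ ≤ ‖ 𝒩 ‖₁
∈⇒∣∣≤‖‖₁ (y ∷ 𝒩) (here refl) = ℕ.m≤m+n ∣ y ∣ ‖ 𝒩 ‖₁
∈⇒∣∣≤‖‖₁ (y ∷ 𝒩) (there x∈𝒩) = ℕ.≤-trans (∈⇒∣∣≤‖‖₁ 𝒩 x∈𝒩) (ℕ.m≤n+m ‖ 𝒩 ‖₁ ∣ y ∣)

∈[x]⇒Bounded : ∀ 𝒩 p → p ∈[x] 𝒩 → Bounded ‖ 𝒩 ‖₁ p
∈[x]⇒Bounded 𝒩 []      []          n       = z≤n
∈[x]⇒Bounded 𝒩 (a ∷ p) (a∈𝒩 ∷ p∈) zero    = ∈⇒∣∣≤‖‖₁ 𝒩 a∈𝒩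
∈[x]⇒Bounded 𝒩 (a ∷ p) (a∈𝒩 ∷ p∈) (suc n) = ∈[x]⇒Bounded 𝒩 p p∈ n

interval : ℕ → List ℤ
interval zero    = 0ℤ ∷ []
interval (suc b) = + suc b ∷ -[1+ b ] ∷ interval b

∣∣≤⇒∈interval : ∀ b z → ∣ z ∣ ≤ b → z ∈ interval b
∣∣≤⇒∈interval zero    (+ zero)  z≤n     = here refl
∣∣≤⇒∈interval (suc b) (+ zero)  z≤n     = there (there (∣∣≤⇒∈interval b (+ zero) z≤n))
∣∣≤⇒∈interval (suc b) (+ suc n) (s≤s n≤b) with ℕ.m≤n⇒m<n∨m≡n n≤b
... | inj₁ n<b  = there (there (∣∣≤⇒∈interval b (+ suc n) n<b))
... | inj₂ refl = here refl
∣∣≤⇒∈interval (suc b) -[1+ n ]  (s≤s n≤b) with ℕ.m≤n⇒m<n∨m≡n n≤b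
... | inj₁ n<b  = there (there (∣∣≤⇒∈interval b -[1+ n ] n<b))
... | inj₂ refl = there (here refl)

Bounded⇒∈[x]interval : ∀ b p → Bounded b p → p ∈[x] interval b
Bounded⇒∈[x]interval b []      p≤b = []
Bounded⇒∈[x]interval b (a ∷ p) p≤b =
  ∣∣≤⇒∈interval b a (p≤b zero) ∷ Bounded⇒∈[x]interval b p (λ n → p≤b (suc n))

BoundedCover : ℕ → Poly → Set
BoundedCover b P = ∀ (F : Poly) → Σ Poly λ R → Σ Poly λ S →
  Bounded b R × (F ≈ₚ (R +ₚ (S *ₚ P)))

CoversZx⇒BoundedCover : ∀ 𝒩 P → CoversZx 𝒩 P → BoundedCover ‖ 𝒩 ‖₁ P
CoversZx⇒BoundedCover 𝒩 P cover F with cover F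
... | R , S , R∈𝒩[x] , F≈ = R , S , ∈[x]⇒Bounded 𝒩 R R∈𝒩[x] , F≈

BoundedCover⇒CoversZx : ∀ b P → BoundedCover b P → CoversZx (interval b) P
BoundedCover⇒CoversZx b P cover F with cover F
... | R , S , R≤b , F≈ = R , S , Bounded⇒∈[x]interval b R R≤b , F≈

BoundedCover-one : BoundedCover 0 (1ℤ ∷ [])
BoundedCover-one F = [] , F , (λ n → z≤n) , λ n → sym (*ₚ-identityʳ F n)

BoundedCover-*ₚ : ∀ {a b} P Q → BoundedCover a P → BoundedCover b Q →
                  BoundedCover (b ℕ.+ a ℕ.* ‖ Q ‖₁) (P *ₚ Q)
BoundedCover-*ₚ P Q coverP coverQ F with coverQ F
... | R , S , R≤b , F≈R+SQ with coverP S
... | R′ , S′ , R′≤a , S≈R′+S′P =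
  R +ₚ (R′ *ₚ Q) , S′ , Bounded-+ₚ R (R′ *ₚ Q) R≤b (Bounded-*ₚ R′ Q R′≤a) , F≈
  where
  open ≈ₚ-Reasoning
  F≈ : F ≈ₚ ((R +ₚ (R′ *ₚ Q)) +ₚ (S′ *ₚ (P *ₚ Q)))
  F≈ = begin
    F                                           ≈⟨ F≈R+SQ ⟩
    R +ₚ (S *ₚ Q)                               ≈⟨ +ₚ-cong R R (S *ₚ Q) _ (λ _ → refl) SQ≈ ⟩
    R +ₚ ((R′ *ₚ Q) +ₚ (S′ *ₚ (P *ₚ Q)))        ≈⟨ (λ n → sym (+ₚ-assoc R (R′ *ₚ Q) (S′ *ₚ (P *ₚ Q)) n)) ⟩
    (R +ₚ (R′ *ₚ Q)) +ₚ (S′ *ₚ (P *ₚ Q))        ∎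
    where
    SQ≈ : (S *ₚ Q) ≈ₚ ((R′ *ₚ Q) +ₚ (S′ *ₚ (P *ₚ Q)))
    SQ≈ = begin
      S *ₚ Q                                    ≈⟨ *ₚ-congˡ S (R′ +ₚ (S′ *ₚ P)) Q S≈R′+S′P ⟩
      (R′ +ₚ (S′ *ₚ P)) *ₚ Q                    ≈⟨ *ₚ-distribʳ-+ₚ R′ (S′ *ₚ P) Q ⟩
      (R′ *ₚ Q) +ₚ ((S′ *ₚ P) *ₚ Q)             ≈⟨ +ₚ-cong (R′ *ₚ Q) (R′ *ₚ Q) ((S′ *ₚ P) *ₚ Q) _ (λ _ → refl) (*ₚ-assoc S′ P Q) ⟩
      (R′ *ₚ Q) +ₚ (S′ *ₚ (P *ₚ Q))             ∎

BoundedCover-^ₚ : ∀ {a} P → BoundedCover a P → ∀ m → Σ ℕ λ b → BoundedCover b (P ^ₚ m)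
BoundedCover-^ₚ P coverP zero    = 0 , BoundedCover-one
BoundedCover-^ₚ {a} P coverP (suc m) with BoundedCover-^ₚ P coverP m
... | b , coverPᵐ = b ℕ.+ a ℕ.* ‖ P ^ₚ m ‖₁ , BoundedCover-*ₚ P (P ^ₚ m) coverP coverPᵐ

corollary1 : (P : Poly) (𝒩 : List ℤ) → CoversZx 𝒩 P →
    (m : ℕ) → Σ (List ℤ) λ 𝒩ₘ → CoversZx 𝒩ₘ (P ^ₚ m)
corollary1 P 𝒩 cover m with BoundedCover-^ₚ P (CoversZx⇒BoundedCover 𝒩 P cover) m
... | b , coverPᵐ = interval b , BoundedCover⇒CoversZx b (P ^ₚ m) coverPᵐ
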